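{- Let $\mathcal A$ be a well-founded $\Sigma$-algebra, $\succsim$ a quasi-precedence and $\sigma$ a status. If $\mathcal A$ is strictly simple, then $\succ_{\mathrm{GKBO}}=\succ_{\mathrm{WPO}}$, where both orders are induced by $\mathcal A$, $\succsim$ and $\sigma$.
   Context: Terms over a finite signature $\Sigma$ and variables $\mathcal V$. A well-founded $\Sigma$-algebra $\mathcal{A}=(A,\geq,>,(f_{\mathcal A}))$: carrier $A$, quasi-order $\geq$, well-founded strict order $>$ with ${\geq}\circ{>}\circ{\geq}\subseteq{>}$, and $f_{\mathcal A}:A^n\to A$ for $f\in\Sigma_n$. On terms, $s\geq_{\mathcal A}t$ (resp. $>_{\mathcal A}$) iff $\hat\alpha(s)\geq\hat\alpha(t)$ (resp. $>$) for all assignments $\alpha:\mathcal V\to A$. $\mathcal A$ is strictly simple iff $f_{\mathcal A}(\dots,a,\dots)>a$ for every $f$ and argument position. A quasi-precedence $\succsim$ is a quasi-order on $\Sigma$ with well-founded strict part $\succ$ and equivalence part $\sim$. A status $\sigma$ maps $f\in\Sigma_n$ to a permutation $[i_1,\dots,i_n]$ of $\{1,\dots,n\}$, and $\sigma(f)(s_1,\dots,s_n)=[s_{i_1},\dots,s_{i_n}]$. For a strict order $\succ$ with reflexive closure $\succeq$: $[s_1,\dots,s_n]\succ^{\mathrm{lex}}[t_1,\dots,t_m]$ iff there is $k<n$ with $s_i\succeq t_i$ for $i\le k$ and either $k=m$, or $k<m$ and $s_{k+1}\succ t_{k+1}$. GKBO: no variable is greater than any term; $s=f(s_1,\dots,s_n)\succ_{\mathrm{GKBO}}t$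 iff (1) $s>_{\mathcal A}t$, or (2) $s\geq_{\mathcal A}t=g(t_1,\dots,t_m)$ and either $f\succ g$, or $f\sim g$ and $\sigma(f)(s_1,\dots,s_n)\succ_{\mathrm{GKBO}}^{\mathrm{lex}}\sigma(g)(t_1,\dots,t_m)$. WPO: no variable is greater than any term; $s=f(s_1,\dots,s_n)\succ_{\mathrm{WPO}}t$ iff (1) $s>_{\mathcal A}t$, or (2) $s\geq_{\mathcal A}t$ and either (a) $s_i\succeq_{\mathrm{WPO}}t$ for some $i\in\{1,\dots,n\}$, or (b) $t=g(t_1,\dots,t_m)$, $s\succ_{\mathrm{WPO}}t_j$ for all $j$, and either $f\succ g$, or $f\sim g$ and $\sigma(f)(s_1,\dots,s_n)\succ_{\mathrm{WPO}}^{\mathrm{lex}}\sigma(g)(t_1,\dots,t_m)$. -}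

module Defs where

open import Level using (Level; _⊔_; suc)
open import Data.Nat using (ℕ)
open import Data.Fin using (Fin)
open import Data.Fin.Permutation using (Permutation′; _⟨$⟩ʳ_)
open import Data.Vec using (Vec; []; _∷_; lookup; tabulate; toList)
open import Data.List using (List; []; _∷_)
open import Data.Product using (_×_)
open import Data.Sum using (_⊎_)
open import Relation.Nullary using (¬_)
open import Relation.Binary.Core using (Rel)
open import Relation.Binary.Structures using (IsPreorder; IsStrictPartialOrder)
open import Relation.Binary.PropositionalEquality using (_≡_)
open import Induction.WellFounded using (WellFounded)
open import Function using (flip)

module Terms {k : ℕ} (arity : Fin k → ℕ) (V : Set) where

  data Term : Set where
    var : V → Term
    fun : (f : Fin k) → Vec Term (arity f) → Term

record WFAlgebra {k : ℕ} (arity : Fin k → ℕ) (a ℓ₁ ℓ₂ : Level)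
       : Set (suc (a ⊔ ℓ₁ ⊔ ℓ₂)) where
  field
    Carrier   : Set a
    _≥_       : Rel Carrier ℓ₁
    _>_       : Rel Carrier ℓ₂
    ≥-quasi   : IsPreorder _≡_ _≥_
    >-strict  : IsStrictPartialOrder _≡_ _>_
    >-wf      : WellFounded (flip _>_)
    compat    : ∀ {a b c d} → a ≥ b → b > c → c ≥ d → a > d
    interp    : (f : Fin k) → Vec Carrier (arity f) → Carrier

StrictlySimple : ∀ {k} {arity : Fin k → ℕ} {a ℓ₁ ℓ₂} →
                 WFAlgebra arity a ℓ₁ ℓ₂ → Set (a ⊔ ℓ₂)
StrictlySimple {k} {arity} 𝒜 =
  ∀ (f : Fin k) (as : Vec Carrier (arity f)) (i : Fin (arity f)) →
    interp f as > lookup as i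
  where open WFAlgebra 𝒜

record QuasiPrecedence (k : ℕ) (ℓ : Level) : Set (suc ℓ) where
  field
    _≿_      : Rel (Fin k) ℓ
    isQuasi  : IsPreorder _≡_ _≿_
  _≻_ : Rel (Fin k) ℓ
  f ≻ g = f ≿ g × ¬ (g ≿ f)
  _∼_ : Rel (Fin k) ℓ
  f ∼ g = f ≿ g × g ≿ f
  field
    ≻-wf     : WellFounded (flip _≻_)

Status : ∀ {k} → (Fin k → ℕ) → Set
Status {k} arity = (f : Fin k) → Permutation′ (arity f)

-- Lexicographic extension of a strict order R (reflexive closure R ∪ ≡):
-- [s₁…sₙ] ≻lex [t₁…tₘ] iff ∃ k < n, sᵢ ⪰ tᵢ (i ≤ k) and either k = m,
-- or k < m and s_{k+1} ≻ t_{k+1}.  Inductive unfolding of that definition.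

data Lex {a ℓ} {X : Set a} (R : Rel X ℓ) : Rel (List X) (a ⊔ ℓ) where
  lex-nil    : ∀ {s ss} → Lex R (s ∷ ss) []
  lex-strict : ∀ {s t ss ts} → R s t → Lex R (s ∷ ss) (t ∷ ts)
  lex-weak   : ∀ {s t ss ts} → (R s t ⊎ s ≡ t) → Lex R ss ts →
               Lex R (s ∷ ss) (t ∷ ts)

module Orders {k : ℕ} {arity : Fin k → ℕ} {V : Set} {a ℓ₁ ℓ₂ ℓp : Level}
              (𝒜 : WFAlgebra arity a ℓ₁ ℓ₂)
              (prec : QuasiPrecedence k ℓp)
              (σ : Status arity) where

  open Terms arity V public
  open WFAlgebra 𝒜
  open QuasiPrecedence prec

  mutual
    eval : (V → Carrier) → Term → Carrier
    eval α (var x)    = α x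
    eval α (fun f ts) = interp f (evals α ts)

    evals : ∀ {n} → (V → Carrier) → Vec Term n → Vec Carrier n
    evals α []       = []
    evals α (t ∷ ts) = eval α t ∷ evals α ts

  _≥𝒜_ : Rel Term (a ⊔ ℓ₁)
  s ≥𝒜 t = ∀ (α : V → Carrier) → eval α s ≥ eval α t

  _>𝒜_ : Rel Term (a ⊔ ℓ₂)
  s >𝒜 t = ∀ (α : V → Carrier) → eval α s > eval α t

  applyStatus : (f : Fin k) → Vec Term (arity f) → List Term
  applyStatus f ss = toList (tabulate (λ j → lookup ss (σ f ⟨$⟩ʳ j)))

  data _≻GKBO_ : Rel Term (a ⊔ ℓ₁ ⊔ ℓ₂ ⊔ ℓp) where
    gkbo-1    : ∀ {f ss t} → fun f ss >𝒜 t → fun f ss ≻GKBO t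
    gkbo-2prec : ∀ {f ss g ts} → fun f ss ≥𝒜 fun g ts → f ≻ g →
                 fun f ss ≻GKBO fun g ts
    gkbo-2lex : ∀ {f ss g ts} → fun f ss ≥𝒜 fun g ts → f ∼ g →
                Lex _≻GKBO_ (applyStatus f ss) (applyStatus g ts) →
                fun f ss ≻GKBO fun g ts

  data _≻WPO_ : Rel Term (a ⊔ ℓ₁ ⊔ ℓ₂ ⊔ ℓp) where
    wpo-1     : ∀ {f ss t} → fun f ss >𝒜 t → fun f ss ≻WPO t
    wpo-2a    : ∀ {f ss t} → fun f ss ≥𝒜 t → (i : Fin (arity f)) →
                (lookup ss i ≻WPO t ⊎ lookup ss i ≡ t) →
                fun f ss ≻WPO t
    wpo-2bprec : ∀ {f ss g ts} → fun f ss ≥𝒜 fun g ts →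
                 (∀ (j : Fin (arity g)) → fun f ss ≻WPO lookup ts j) →
                 f ≻ g → fun f ss ≻WPO fun g ts
    wpo-2blex : ∀ {f ss g ts} → fun f ss ≥𝒜 fun g ts →
                (∀ (j : Fin (arity g)) → fun f ss ≻WPO lookup ts j) →
                f ∼ g →
                Lex _≻WPO_ (applyStatus f ss) (applyStatus g ts) →
                fun f ss ≻WPO fun g ts

module Submission where

-- The two definitions differ only in WPO's clause (2a) and in WPO's extra side
-- condition in (2b) that s dominates every argument of t.  In a strictly simple
-- algebra both are harmless: s ≥𝒜 g(t₁,…,tₘ) >𝒜 tⱼ makes the side condition
-- follow from clause (1), and s >𝒜 sᵢ ⪰WPO t makes every instance of (2a) an
-- instance of clause (1).

open import Defs
open import Level using (Level)
open import Data.Nat using (ℕ)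
open import Data.Fin using (Fin; zero; suc)
open import Data.Vec using (Vec; _∷_; lookup)
open import Data.Sum using (inj₁; inj₂)
open import Function.Bundles using (_⇔_; mk⇔)
open import Relation.Binary.Structures using (IsPreorder; IsStrictPartialOrder)
open import Relation.Binary.PropositionalEquality using (_≡_; refl; subst)

module _ {k : ℕ} {arity : Fin k → ℕ} {V : Set} {a ℓ₁ ℓ₂ ℓp : Level}
         (𝒜 : WFAlgebra arity a ℓ₁ ℓ₂) (prec : QuasiPrecedence k ℓp)
         (σ : Status arity) where

  open Orders {V = V} 𝒜 prec σ
  open WFAlgebra 𝒜

  private
    ≥-refl : ∀ {x} → x ≥ x
    ≥-refl = IsPreorder.refl ≥-quasi

    >-trans : ∀ {x y z} → x > y → y > z → x > z
    >-trans = IsStrictPartialOrder.trans >-strict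

  lookup-evals : ∀ {n} (α : V → Carrier) (ts : Vec Term n) (i : Fin n) →
                 lookup (evals α ts) i ≡ eval α (lookup ts i)
  lookup-evals α (t ∷ ts) zero    = refl
  lookup-evals α (t ∷ ts) (suc i) = lookup-evals α ts i

  ≥𝒜-trans->𝒜 : ∀ {s u t} → s ≥𝒜 u → u >𝒜 t → s >𝒜 t
  ≥𝒜-trans->𝒜 s≥u u>t α = compat (s≥u α) (u>t α) ≥-refl

  >𝒜-trans-≻WPO : ∀ {u s t} → u >𝒜 s → s ≻WPO t → u >𝒜 t
  >𝒜-trans-≻WPO u>s (wpo-1 s>t)            α = >-trans (u>s α) (s>t α)
  >𝒜-trans-≻WPO u>s (wpo-2a s≥t _ _)        α = compat ≥-refl (u>s α) (s≥t α)
  >𝒜-trans-≻WPO u>s (wpo-2bprec s≥t _ _)    α = compat ≥-refl (u>s α) (s≥t α)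
  >𝒜-trans-≻WPO u>s (wpo-2blex s≥t _ _ _)   α = compat ≥-refl (u>s α) (s≥t α)

  module _ (simple : StrictlySimple 𝒜) where

    >𝒜-subterm : ∀ f (ts : Vec Term (arity f)) (i : Fin (arity f)) →
                 fun f ts >𝒜 lookup ts i
    >𝒜-subterm f ts i α =
      subst (eval α (fun f ts) >_) (lookup-evals α ts i) (simple f (evals α ts) i)

    ≥𝒜⇒≻WPO-args : ∀ {f ss g ts} → fun f ss ≥𝒜 fun g ts →
                   ∀ j → fun f ss ≻WPO lookup ts j
    ≥𝒜⇒≻WPO-args {f} {ss} {g} {ts} s≥t j =
      wpo-1 (≥𝒜-trans->𝒜 {fun f ss} {fun g ts} {lookup ts j} s≥t (>𝒜-subterm g ts j))

    mutual
      ≻GKBO⇒≻WPO : ∀ {s t} → s ≻GKBO t → s ≻WPO t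
      ≻GKBO⇒≻WPO (gkbo-1 s>t)          = wpo-1 s>t
      ≻GKBO⇒≻WPO (gkbo-2prec s≥t f≻g)  = wpo-2bprec s≥t (≥𝒜⇒≻WPO-args s≥t) f≻g
      ≻GKBO⇒≻WPO (gkbo-2lex s≥t f∼g l) =
        wpo-2blex s≥t (≥𝒜⇒≻WPO-args s≥t) f∼g (Lex-≻GKBO⇒≻WPO l)

      Lex-≻GKBO⇒≻WPO : ∀ {xs ys} → Lex _≻GKBO_ xs ys → Lex _≻WPO_ xs ys
      Lex-≻GKBO⇒≻WPO lex-nil                = lex-nil
      Lex-≻GKBO⇒≻WPO (lex-strict x≻y)       = lex-strict (≻GKBO⇒≻WPO x≻y)
      Lex-≻GKBO⇒≻WPO (lex-weak (inj₁ x≻y) l) =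
        lex-weak (inj₁ (≻GKBO⇒≻WPO x≻y)) (Lex-≻GKBO⇒≻WPO l)
      Lex-≻GKBO⇒≻WPO (lex-weak (inj₂ x≡y) l) = lex-weak (inj₂ x≡y) (Lex-≻GKBO⇒≻WPO l)

    mutual
      ≻WPO⇒≻GKBO : ∀ {s t} → s ≻WPO t → s ≻GKBO t
      ≻WPO⇒≻GKBO (wpo-1 s>t) = gkbo-1 s>t
      ≻WPO⇒≻GKBO {fun f ss} (wpo-2a _ i (inj₁ sᵢ≻t)) =
        gkbo-1 (>𝒜-trans-≻WPO {u = fun f ss} (>𝒜-subterm f ss i) sᵢ≻t)
      ≻WPO⇒≻GKBO {fun f ss} (wpo-2a _ i (inj₂ refl)) = gkbo-1 (>𝒜-subterm f ss i)
      ≻WPO⇒≻GKBO (wpo-2bprec s≥t _ f≻g)    = gkbo-2prec s≥t f≻g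
      ≻WPO⇒≻GKBO (wpo-2blex s≥t _ f∼g l)   = gkbo-2lex s≥t f∼g (Lex-≻WPO⇒≻GKBO l)

      Lex-≻WPO⇒≻GKBO : ∀ {xs ys} → Lex _≻WPO_ xs ys → Lex _≻GKBO_ xs ys
      Lex-≻WPO⇒≻GKBO lex-nil                = lex-nil
      Lex-≻WPO⇒≻GKBO (lex-strict x≻y)       = lex-strict (≻WPO⇒≻GKBO x≻y)
      Lex-≻WPO⇒≻GKBO (lex-weak (inj₁ x≻y) l) =
        lex-weak (inj₁ (≻WPO⇒≻GKBO x≻y)) (Lex-≻WPO⇒≻GKBO l)
      Lex-≻WPO⇒≻GKBO (lex-weak (inj₂ x≡y) l) = lex-weak (inj₂ x≡y) (Lex-≻WPO⇒≻GKBO l)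

theorem15 : ∀ {k : ℕ} {arity : Fin k → ℕ} {V : Set} {a ℓ₁ ℓ₂ ℓp : Level}
              (𝒜 : WFAlgebra arity a ℓ₁ ℓ₂) (prec : QuasiPrecedence k ℓp)
              (σ : Status arity) →
              StrictlySimple 𝒜 →
              ∀ (s t : Orders.Term {V = V} 𝒜 prec σ) →
              (Orders._≻GKBO_ 𝒜 prec σ s t ⇔ Orders._≻WPO_ 𝒜 prec σ s t)
theorem15 {V = V} 𝒜 prec σ simple s t =
  mk⇔ (≻GKBO⇒≻WPO {V = V} 𝒜 prec σ simple) (≻WPO⇒≻GKBO {V = V} 𝒜 prec σ simple)
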